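{- Let $\mathcal{B}_1$ be an arbitrary set of mini-batches and let $(f,f)\in\mathcal{B}_1$ be an atomic mini-batch. If $$n(f)\Big(l(f)+\sum_{b\in\mathcal{B}_1,\ b<f}s(b)\Big) < s(f)\Big(\sum_{f'<f}n(f')+\sum_{f'\notin\mathcal{F}(\mathcal{B}_1),\ f'>f}n(f')\Big),$$ then $v(\mathcal{B}_1\setminus\{(f,f)\})<v(\mathcal{B}_1)$.
   Context: Tape model (Linear Tape Scheduling Problem, LTSP). A single-track tape stores files $f_1,\dots,f_n$ in this order from left to right; positions (blocks) are $1,\dots,m$. File $f$ occupies blocks $l(f),\dots,r(f)$, with $l(f_1)=1$, $l(f_{i+1})=r(f_i)+1$, $r(f_n)=m$; its size is $s(f)=r(f)-l(f)+1\ge 1$. For files write $f<f'$ if $l(f)<l(f')$. A finite set of read requests is given, each associated with one file; $n(f)$ is the number of requests associated with $f$. The read head is at position $m$ at time $0$ and moves at unit speed (one block per time step), possibly changing direction. A file $f$ is read when the head traverses it rightwards from $l(f)$ to $r(f)$; the time such a traversal begins is a read time of $f$. All requests are released at time $0$; a request is serviced at the first read time of its file, which is its response time. Mini-batches. A mini-batch is a pair $b=(f,f')$ of files with $l(f)\le l(f')$; $l(b)=l(f)$, $r(b)=r(f')$, $s(b)=r(b)-l(b)+1$, and $\mathcal{F}(b)$ is the set of files $g$ with $l(b)\le l(g)$ and $r(g)\le r(b)$; $b$ is atomic if $f=f'$. $\mathcal{F}(\mathcal{B}_1)=\bigcup_{b\in\mathcal{B}_1}\mathcal{F}(b)$, and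 for $b\in\mathcal{B}_1$ and a file $f$ write $b<f$ if $l(b)<l(f)$. The schedule associated with $\mathcal{B}_1$: starting at $m$, the head moves leftwards to position $1$; whenever it reaches for the first time the block $l(b)$ of some $b\in\mathcal{B}_1$, it moves rightwards to $r(b)$ and back to $l(b)$ (if several mini-batches share that block they are executed consecutively), then continues leftwards; after reaching position $1$ it moves rightwards to $m$, reading every file. $v(\mathcal{B}_1)$ denotes the total response time of this schedule. -}

module Defs where

open import Data.Nat using (ℕ; zero; suc; _+_; _*_; _∸_; _≤ᵇ_)
open import Data.Bool using (Bool; true; false; _∧_; if_then_else_)
open import Data.Fin using (Fin; toℕ)
open import Data.Fin.Properties using (_≟_)
import Data.Fin as F
open import Data.List using (List; []; _∷_; _++_; map; filter; allFin; reverse; concatMap)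
open import Data.Nat.ListAction using (sum)
open import Data.Bool.ListAction using (any)
open import Relation.Nullary using (Dec)
open import Relation.Binary.PropositionalEquality using (_≡_)
import Data.Nat
import Data.Bool
open import Data.Maybe using (Maybe; just; nothing; fromMaybe)
open import Data.Product using (_×_; _,_; proj₁; proj₂)
open import Relation.Nullary using (¬_; ¬?)
open import Relation.Nullary.Decidable using (⌊_⌋)
open import Data.Product.Properties using (≡-dec)

-- Files are indexed by Fin n (f_1 < ... < f_n becomes 0 < ... < n-1);
-- a tape is given by the sizes  s : Fin n → ℕ.
Sizes : ℕ → Set
Sizes n = Fin n → ℕ

Requests : ℕ → Set
Requests n = Fin n → ℕ

sumBelow : ∀ {n} → (Fin n → ℕ) → Fin n → ℕ
sumBelow {n} g i = sum (map g (filter (F._<? i) (allFin n)))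

tapeLength : ∀ {n} → Sizes n → ℕ
tapeLength {n} s = sum (map s (allFin n))

lft : ∀ {n} → Sizes n → Fin n → ℕ
lft s i = suc (sumBelow s i)

rgt : ∀ {n} → Sizes n → Fin n → ℕ
rgt s i = sumBelow s i + s i

-- A mini-batch (f , f') of files; valid iff l(f) ≤ l(f'), i.e. f ≤ f'.
MiniBatch : ℕ → Set
MiniBatch n = Fin n × Fin n

ValidMB : ∀ {n} → MiniBatch n → Set
ValidMB (f , f') = f F.≤ f'

lB : ∀ {n} → Sizes n → MiniBatch n → ℕ
lB s b = lft s (proj₁ b)

rB : ∀ {n} → Sizes n → MiniBatch n → ℕ
rB s b = rgt s (proj₂ b)

sB : ∀ {n} → Sizes n → MiniBatch n → ℕ
sB s b = suc (rB s b) ∸ lB s b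

inFb : ∀ {n} → Sizes n → MiniBatch n → Fin n → Bool
inFb s b g = (lB s b ≤ᵇ lft s g) ∧ (rgt s g ≤ᵇ rB s b)

inFB : ∀ {n} → Sizes n → List (MiniBatch n) → Fin n → Bool
inFB s B g = any (λ b → inFb s b g) B

_≟MB_ : ∀ {n} (b c : MiniBatch n) → Dec (b ≡ c)
_≟MB_ = ≡-dec _≟_ _≟_

removeMB : ∀ {n} → MiniBatch n → List (MiniBatch n) → List (MiniBatch n)
removeMB b B = filter (λ c → ¬? (c ≟MB b)) B

-- The schedule, modelled as a path of the head.
-- Coordinates: block k occupies the unit interval [k-1, k]; the head
-- starts at coordinate m (right end of the tape).  Reading block k takes
-- one time unit, so a detour for b costs 2 s(b).  Reaching block l(b) for
-- the first time means reaching coordinate l(b) - 1.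

leftCoord : ∀ {n} → Sizes n → Fin n → ℕ
leftCoord s i = sumBelow s i

waypointsAt : ∀ {n} → Sizes n → List (MiniBatch n) → Fin n → List ℕ
waypointsAt s B i =
  leftCoord s i ∷ concatMap (λ b → rB s b ∷ leftCoord s i ∷ [])
                            (filter (λ b → proj₁ b ≟ i) B)

schedule : ∀ {n} → Sizes n → List (MiniBatch n) → List ℕ
schedule {n} s B =
  concatMap (waypointsAt s B) (reverse (allFin n)) ++ (0 ∷ tapeLength s ∷ [])

dist : ℕ → ℕ → ℕ
dist p q = (p ∸ q) + (q ∸ p)

-- first time the head, starting at coordinate pos at time t and following
-- the waypoints, begins a rightward traversal of the interval [a , e]
firstRead : ℕ → ℕ → ℕ → ℕ → List ℕ → Maybe ℕ
firstRead a e pos t [] = nothing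
firstRead a e pos t (q ∷ qs) =
  if (pos ≤ᵇ a) ∧ (e ≤ᵇ q)
  then just (t + (a ∸ pos))
  else firstRead a e q (t + dist pos q) qs

-- response time of (every request of) file f  (the final sweep always
-- reads f, so the default 0 is never used)
respTime : ∀ {n} → Sizes n → List (MiniBatch n) → Fin n → ℕ
respTime s B f =
  fromMaybe 0 (firstRead (leftCoord s f) (rgt s f) (tapeLength s) 0 (schedule s B))

v : ∀ {n} → Sizes n → Requests n → List (MiniBatch n) → ℕ
v {n} s req B = sum (map (λ f → req f * respTime s B f) (allFin n))

sumBatchesLeftOf : ∀ {n} → Sizes n → List (MiniBatch n) → Fin n → ℕ
sumBatchesLeftOf s B f = sum (map (sB s) (filter (λ b → lB s b Data.Nat.<? lft s f) B))

reqLeftOf : ∀ {n} → Sizes n → Requests n → Fin n → ℕ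
reqLeftOf {n} s req f = sum (map req (filter (λ g → lft s g Data.Nat.<? lft s f) (allFin n)))

reqRightUncovered : ∀ {n} → Sizes n → Requests n → List (MiniBatch n) → Fin n → ℕ
reqRightUncovered {n} s req B f =
  sum (map req (filter (λ g → lft s f Data.Nat.<? lft s g)
                 (filter (λ g → Data.Bool._≟_ (inFB s B g) false) (allFin n))))

module Submission where

-- Removing the atomic mini-batch (f, f) deletes the detour l(f) → r(f) → l(f) from the
-- head's path and changes nothing else.  A file g ≠ f is never read later than before,
-- and it is read exactly 2 s(f) earlier whenever it had not been read when the detour
-- started: this is the case for every file left of f (the head has not yet passed l(f))
-- and for every file right of f outside F(B₁) (no detour so far covered it).  The
-- requests of f were served by the start of the detour at the latest; without it they
-- are served by a later detour of a mini-batch starting at f, or else on the final sweep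
-- after the detours of the mini-batches left of f, so they wait at most
-- 2 (l(f) − 1 + Σ_{b<f} s(b)) longer.  Weighing this loss on n(f) requests against the
-- gain 2 s(f) on the others gives the claim.

open import Data.Bool using (true; false; _∧_; T; if_then_else_)
import Data.Bool as Bool
open import Data.Bool.Properties using (T-∧)
open import Data.Empty using (⊥-elim)
open import Data.Fin using (Fin)
import Data.Fin as F
open import Data.Fin.Properties using (_≟_)
import Data.Fin.Properties as FP
open import Data.List using (List; []; _∷_; _++_; map; filter; concatMap; allFin; reverse)
open import Data.List.Membership.Propositional using (_∈_)
open import Data.List.Membership.Propositional.Properties using (∈-allFin; ∈-∃++)
open import Data.List.Properties
  using (map-cong; map-++; filter-all; filter-none; filter-accept; filter-reject; filter-++;
         ++-assoc; ++-identityʳ; concatMap-++; unfold-reverse)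
open import Data.List.Relation.Binary.Permutation.Propositional using (_↭_; ↭-sym; ↭-trans; ↭-reflexive)
import Data.List.Relation.Binary.Permutation.Propositional.Properties as ↭
open import Data.List.Relation.Unary.All using (All; []; _∷_)
import Data.List.Relation.Unary.All as All
open import Data.List.Relation.Unary.All.Properties using (all-filter; filter⁺; ++⁺; ++⁻ˡ; ++⁻ʳ; ¬Any⇒All¬)
open import Data.List.Relation.Unary.AllPairs using (AllPairs; []; _∷_) renaming (map to AllPairs-map)
import Data.List.Relation.Unary.AllPairs.Properties as AllPairs
open import Data.List.Relation.Unary.Any using (here; there)
import Data.List.Relation.Unary.Any.Properties as Any
open import Data.List.Relation.Unary.Unique.Propositional using (Unique)
open import Data.Maybe using (just; nothing; fromMaybe; _<∣>_)
import Data.Maybe as Maybe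
open import Data.Nat using (ℕ; _+_; _*_; _∸_; _≤_; _<_; _≤ᵇ_; _<?_; z≤n; s≤s)
open import Data.Nat.ListAction using (sum)
open import Data.Nat.ListAction.Properties using (sum-↭; sum-++)
open import Data.Nat.Properties hiding (_≟_)
open import Algebra.Properties.CommutativeSemigroup +-commutativeSemigroup using (interchange; xy∙z≈xz∙y)
open import Data.Nat.Tactic.RingSolver using (solve-∀)
open import Data.Product using (_,_; _×_; proj₁; proj₂; ∃)
open import Data.Unit using (tt)
open import Function using (_∘_; flip; id)
open import Function.Bundles using (Equivalence)
open import Level using (0ℓ)
open import Relation.Binary.Definitions using (DecidableEquality; tri<; tri≈; tri>)
open import Relation.Binary.PropositionalEquality
open import Relation.Nullary using (¬_; ¬?; Dec; yes; no; does)
open import Relation.Nullary.Decidable using (_×-dec_; map′)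
open import Relation.Unary using (Pred; Decidable)
open import Relation.Unary.Properties using (U?)

open import Defs

module _ {A : Set} where

  sum-map-+ : (g h : A → ℕ) (xs : List A) →
              sum (map (λ x → g x + h x) xs) ≡ sum (map g xs) + sum (map h xs)
  sum-map-+ g h [] = refl
  sum-map-+ g h (x ∷ xs) rewrite sum-map-+ g h xs = interchange (g x) (h x) _ _

  sum-map-*ˡ : (c : ℕ) (h : A → ℕ) (xs : List A) →
               sum (map (λ x → c * h x) xs) ≡ c * sum (map h xs)
  sum-map-*ˡ c h [] = sym (*-zeroʳ c)
  sum-map-*ˡ c h (x ∷ xs) rewrite sum-map-*ˡ c h xs = sym (*-distribˡ-+ c (h x) _)

  sum-map-mono : {g h : A → ℕ} {xs : List A} → All (λ x → g x ≤ h x) xs →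
                 sum (map g xs) ≤ sum (map h xs)
  sum-map-mono []         = z≤n
  sum-map-mono (le ∷ les) = +-mono-≤ le (sum-map-mono les)

  sum-map-zero : (xs : List A) → sum (map (λ _ → 0) xs) ≡ 0
  sum-map-zero []       = refl
  sum-map-zero (_ ∷ xs) = sum-map-zero xs

  sum-map-↭ : (h : A → ℕ) {xs ys : List A} → xs ↭ ys → sum (map h xs) ≡ sum (map h ys)
  sum-map-↭ h = sum-↭ ∘ ↭.map⁺ h

  sum-map-gain : {g d h : A → ℕ} {xs : List A} → All (λ x → g x + d x ≤ h x) xs →
                 sum (map g xs) + sum (map d xs) ≤ sum (map h xs)
  sum-map-gain {g} {d} {xs = xs} gains = ≤-trans (≤-reflexive (sym (sum-map-+ g d xs))) (sum-map-mono gains)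

  sum-map-filter-gain : {P : Pred A 0ℓ} (P? : Decidable P) {g d h : A → ℕ} {xs : List A} →
    All (λ x → g x ≤ h x) xs → All (λ x → P x → g x + d x ≤ h x) xs →
    sum (map g xs) + sum (map d (filter P? xs)) ≤ sum (map h xs)
  sum-map-filter-gain P? [] [] = z≤n
  sum-map-filter-gain P? {g} {d} {h} {x ∷ xs} (g≤h ∷ g≤hs) (gain ∷ gains) with P? x
  ... | yes Px = begin
    g x + sum (map g xs) + (d x + sum (map d (filter P? xs)))   ≡⟨ interchange (g x) _ (d x) _ ⟩
    g x + d x + (sum (map g xs) + sum (map d (filter P? xs)))   ≤⟨ +-mono-≤ (gain Px) (sum-map-filter-gain P? g≤hs gains) ⟩
    h x + sum (map h xs)                                        ∎
    where open ≤-Reasoning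
  ... | no _ = begin
    g x + sum (map g xs) + sum (map d (filter P? xs))           ≡⟨ +-assoc (g x) _ _ ⟩
    g x + (sum (map g xs) + sum (map d (filter P? xs)))         ≤⟨ +-mono-≤ g≤h (sum-map-filter-gain P? g≤hs gains) ⟩
    h x + sum (map h xs)                                        ∎
    where open ≤-Reasoning

  module _ {P Q : Pred A 0ℓ} (P? : Decidable P) (Q? : Decidable Q) (h : A → ℕ) where

    sum-filter-mono : (∀ {x} → P x → Q x) → (xs : List A) →
                      sum (map h (filter P? xs)) ≤ sum (map h (filter Q? xs))
    sum-filter-mono P⇒Q [] = z≤n
    sum-filter-mono P⇒Q (x ∷ xs) with P? x | Q? x
    ... | yes _  | yes _  = +-monoʳ-≤ (h x) (sum-filter-mono P⇒Q xs)
    ... | yes px | no ¬qx = ⊥-elim (¬qx (P⇒Q px))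
    ... | no _   | yes _  = ≤-trans (sum-filter-mono P⇒Q xs) (m≤n+m _ (h x))
    ... | no _   | no _   = sum-filter-mono P⇒Q xs

    sum-filter-insert : (∀ {x} → P x → Q x) → ∀ {y} → ¬ P y → Q y →
                        (xs : List A) → y ∈ xs →
                        sum (map h (filter P? xs)) + h y ≤ sum (map h (filter Q? xs))
    sum-filter-insert P⇒Q {y} ¬py qy (x ∷ xs) (there y∈xs) with P? x | Q? x
    ... | yes _  | yes _  = begin
      h x + sum (map h (filter P? xs)) + h y   ≡⟨ +-assoc (h x) _ (h y) ⟩
      h x + (sum (map h (filter P? xs)) + h y) ≤⟨ +-monoʳ-≤ (h x) (sum-filter-insert P⇒Q ¬py qy xs y∈xs) ⟩
      h x + sum (map h (filter Q? xs))         ∎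
      where open ≤-Reasoning
    ... | yes px | no ¬qx = ⊥-elim (¬qx (P⇒Q px))
    ... | no _   | yes _  = ≤-trans (sum-filter-insert P⇒Q ¬py qy xs y∈xs) (m≤n+m _ (h x))
    ... | no _   | no _   = sum-filter-insert P⇒Q ¬py qy xs y∈xs
    sum-filter-insert P⇒Q {y} ¬py qy (y ∷ xs) (here refl) with P? y | Q? y
    ... | yes py | _      = ⊥-elim (¬py py)
    ... | no _   | no ¬qy = ⊥-elim (¬qy qy)
    ... | no _   | yes _  = begin
      sum (map h (filter P? xs)) + h y ≤⟨ +-monoˡ-≤ (h y) (sum-filter-mono P⇒Q xs) ⟩
      sum (map h (filter Q? xs)) + h y ≡⟨ +-comm _ (h y) ⟩
      h y + sum (map h (filter Q? xs)) ∎
      where open ≤-Reasoning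

module _ {A B : Set} (_≟_ : DecidableEquality A) (κ : B → A) (w : B → ℕ) where

  fibreSum : List A → List B → ℕ
  fibreSum is bs = sum (map (λ i → sum (map w (filter (λ b → κ b ≟ i) bs))) is)

  private
    indicator : A → ℕ → A → ℕ
    indicator x u i = if does (x ≟ i) then u else 0

    indicator-sum-≡0 : ∀ {x u is} → All (x ≢_) is → sum (map (indicator x u) is) ≡ 0
    indicator-sum-≡0 []                              = refl
    indicator-sum-≡0 {x} {is = i ∷ _} (x≢i ∷ x∉is) with x ≟ i
    ... | yes x≡i = ⊥-elim (x≢i x≡i)
    ... | no _    = indicator-sum-≡0 x∉is

    indicator-sum-≤ : ∀ {x u is} → Unique is → sum (map (indicator x u) is) ≤ u
    indicator-sum-≤ []                                = z≤n
    indicator-sum-≤ {x} {u} {i ∷ _} (i∉is ∷ unique) with x ≟ i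
    ... | yes refl = ≤-reflexive (trans (cong (u +_) (indicator-sum-≡0 i∉is)) (+-identityʳ u))
    ... | no _     = indicator-sum-≤ unique

    fibre-∷ : ∀ b bs i → sum (map w (filter (λ b′ → κ b′ ≟ i) (b ∷ bs))) ≡
                         indicator (κ b) (w b) i + sum (map w (filter (λ b′ → κ b′ ≟ i) bs))
    fibre-∷ b bs i with κ b ≟ i
    ... | yes _ = refl
    ... | no _  = refl

    fibreSum-∷ : ∀ is b bs → fibreSum is (b ∷ bs) ≡ sum (map (indicator (κ b) (w b)) is) + fibreSum is bs
    fibreSum-∷ is b bs = trans (cong sum (map-cong (fibre-∷ b bs) is)) (sum-map-+ _ _ is)

  fibreSum-≤ : {Q : Pred A 0ℓ} (Q? : Decidable Q) → ∀ {is} → Unique is → All Q is →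
               ∀ bs → fibreSum is bs ≤ sum (map w (filter (Q? ∘ κ) bs))
  fibreSum-≤ Q? {is} unique Qis []       = ≤-reflexive (sum-map-zero is)
  fibreSum-≤ {Q} Q? {is} unique Qis (b ∷ bs) with Q? (κ b)
  ... | yes _  = begin
    fibreSum is (b ∷ bs)                                   ≡⟨ fibreSum-∷ is b bs ⟩
    sum (map (indicator (κ b) (w b)) is) + fibreSum is bs  ≤⟨ +-mono-≤ (indicator-sum-≤ unique) (fibreSum-≤ Q? unique Qis bs) ⟩
    w b + sum (map w (filter (Q? ∘ κ) bs))                 ∎
    where open ≤-Reasoning
  ... | no ¬Qκb = begin
    fibreSum is (b ∷ bs)                                   ≡⟨ fibreSum-∷ is b bs ⟩
    sum (map (indicator (κ b) (w b)) is) + fibreSum is bs  ≡⟨ cong (_+ fibreSum is bs) (indicator-sum-≡0 κb∉is) ⟩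
    fibreSum is bs                                         ≤⟨ fibreSum-≤ Q? unique Qis bs ⟩
    sum (map w (filter (Q? ∘ κ) bs))                       ∎
    where
    open ≤-Reasoning
    κb∉is : All (κ b ≢_) is
    κb∉is = All.map (λ Qi κb≡i → ¬Qκb (subst Q (sym κb≡i) Qi)) Qis

module _ {A : Set} where

  All-reverse⁺ : {P : A → Set} {xs : List A} → All P xs → All P (reverse xs)
  All-reverse⁺ {xs = []}     []         = []
  All-reverse⁺ {xs = x ∷ xs} (px ∷ pxs) rewrite unfold-reverse x xs = ++⁺ (All-reverse⁺ pxs) (px ∷ [])

  AllPairs-reverse⁺ : {R : A → A → Set} {xs : List A} → AllPairs R xs → AllPairs (flip R) (reverse xs)
  AllPairs-reverse⁺ {xs = []}     []         = []
  AllPairs-reverse⁺ {xs = x ∷ xs} (px ∷ pxs) rewrite unfold-reverse x xs =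
    AllPairs.++⁺ (AllPairs-reverse⁺ pxs) ([] ∷ []) (All.map (_∷ []) (All-reverse⁺ px))

  regroup : ∀ (xs ys mid zs ws vs : List A) x →
    (xs ++ ((x ∷ (ys ++ mid ++ zs)) ++ ws)) ++ vs ≡ (xs ++ x ∷ ys) ++ mid ++ ((zs ++ ws) ++ vs)
  regroup xs ys mid zs ws vs x = begin
    (xs ++ ((x ∷ (ys ++ mid ++ zs)) ++ ws)) ++ vs    ≡⟨ ++-assoc xs _ vs ⟩
    xs ++ x ∷ (((ys ++ mid ++ zs) ++ ws) ++ vs)      ≡⟨ cong (λ l → xs ++ x ∷ l) inner ⟩
    xs ++ x ∷ (ys ++ mid ++ ((zs ++ ws) ++ vs))      ≡⟨ ++-assoc xs (x ∷ ys) _ ⟨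
    (xs ++ x ∷ ys) ++ mid ++ ((zs ++ ws) ++ vs)      ∎
    where
    open ≡-Reasoning
    inner : ((ys ++ mid ++ zs) ++ ws) ++ vs ≡ ys ++ mid ++ ((zs ++ ws) ++ vs)
    inner = begin
      ((ys ++ mid ++ zs) ++ ws) ++ vs    ≡⟨ ++-assoc (ys ++ mid ++ zs) ws vs ⟩
      (ys ++ mid ++ zs) ++ ws ++ vs      ≡⟨ ++-assoc ys (mid ++ zs) (ws ++ vs) ⟩
      ys ++ (mid ++ zs) ++ ws ++ vs      ≡⟨ cong (ys ++_) (++-assoc mid zs (ws ++ vs)) ⟩
      ys ++ mid ++ zs ++ ws ++ vs        ≡⟨ cong (λ l → ys ++ mid ++ l) (++-assoc zs ws vs) ⟨
      ys ++ mid ++ (zs ++ ws) ++ vs      ∎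

  AllPairs-split : {R : A → A → Set} (xs : List A) {y : A} {ys : List A} → AllPairs R (xs ++ y ∷ ys) →
    All (flip R y) xs × All (R y) ys × AllPairs R xs × AllPairs R ys
  AllPairs-split []       (Ry ∷ Rys) = [] , Ry , [] , Rys
  AllPairs-split (x ∷ xs) (Rx ∷ Rxs) with AllPairs-split xs Rxs
  ... | xs<y , y<ys , Rxs′ , Rys with ++⁻ʳ xs Rx
  ...   | Rxy ∷ _ = Rxy ∷ xs<y , y<ys , ++⁻ˡ xs Rx ∷ Rxs′ , Rys

record Sweeps (a e p q : ℕ) : Set where
  constructor sweeps
  field
    start≤ : p ≤ a
    end≥   : e ≤ q

sweeps? : ∀ a e p q → Dec (Sweeps a e p q)
sweeps? a e p q =
  map′ (λ (p≤a , e≤q) → sweeps p≤a e≤q) (λ (sweeps p≤a e≤q) → p≤a , e≤q) ((p ≤? a) ×-dec (e ≤? q))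

module _ {a e p q : ℕ} where

  sweepTest-sound : T ((p ≤ᵇ a) ∧ (e ≤ᵇ q)) → Sweeps a e p q
  sweepTest-sound test =
    let (p≤ᵇa , e≤ᵇq) = Equivalence.to T-∧ test in sweeps (≤ᵇ⇒≤ p a p≤ᵇa) (≤ᵇ⇒≤ e q e≤ᵇq)

  sweepTest-complete : Sweeps a e p q → T ((p ≤ᵇ a) ∧ (e ≤ᵇ q))
  sweepTest-complete (sweeps p≤a e≤q) = Equivalence.from T-∧ (≤⇒≤ᵇ p≤a , ≤⇒≤ᵇ e≤q)

  firstRead-sweep : Sweeps a e p q → ∀ t L → firstRead a e p t (q ∷ L) ≡ just (t + (a ∸ p))
  firstRead-sweep sw t L with (p ≤ᵇ a) ∧ (e ≤ᵇ q) | sweepTest-complete sw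
  ... | true | _ = refl

  firstRead-skip : ¬ Sweeps a e p q → ∀ t L → firstRead a e p t (q ∷ L) ≡ firstRead a e q (t + dist p q) L
  firstRead-skip ¬sw t L with (p ≤ᵇ a) ∧ (e ≤ᵇ q) in test
  ... | false = refl
  ... | true  = ⊥-elim (¬sw (sweepTest-sound (subst T (sym test) tt)))


leftward-¬Sweeps : ∀ {a e p q} → a < e → q ≤ p → ¬ Sweeps a e p q
leftward-¬Sweeps a<e q≤p (sweeps p≤a e≤q) = <⇒≱ a<e (≤-trans e≤q (≤-trans q≤p p≤a))

endpoint : ℕ → List ℕ → ℕ
endpoint p []       = p
endpoint p (q ∷ qs) = endpoint q qs

pathLength : ℕ → List ℕ → ℕ
pathLength p []       = 0
pathLength p (q ∷ qs) = dist p q + pathLength q qs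

endpoint-++ : ∀ p L R → endpoint p (L ++ R) ≡ endpoint (endpoint p L) R
endpoint-++ p []      R = refl
endpoint-++ p (q ∷ L) R = endpoint-++ q L R

pathLength-++ : ∀ p L R → pathLength p (L ++ R) ≡ pathLength p L + pathLength (endpoint p L) R
pathLength-++ p []      R = refl
pathLength-++ p (q ∷ L) R rewrite pathLength-++ q L R = sym (+-assoc (dist p q) _ _)

dist-+ʳ : ∀ c ℓ → dist c (c + ℓ) ≡ ℓ
dist-+ʳ c ℓ rewrite m≤n⇒m∸n≡0 (m≤m+n c ℓ) | m+n∸m≡n c ℓ = refl

dist-+ˡ : ∀ c ℓ → dist (c + ℓ) c ≡ ℓ
dist-+ˡ c ℓ rewrite m≤n⇒m∸n≡0 (m≤m+n c ℓ) | m+n∸m≡n c ℓ = +-identityʳ ℓ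

module _ (a e : ℕ) where

  firstRead-++ : ∀ p t L R → firstRead a e p t (L ++ R) ≡
    (firstRead a e p t L <∣> firstRead a e (endpoint p L) (t + pathLength p L) R)
  firstRead-++ p t []      R = cong (λ t′ → firstRead a e p t′ R) (sym (+-identityʳ t))
  firstRead-++ p t (q ∷ L) R with (p ≤ᵇ a) ∧ (e ≤ᵇ q)
  ... | true  = refl
  ... | false rewrite firstRead-++ q (t + dist p q) L R | +-assoc t (dist p q) (pathLength q L) = refl

  firstRead-delay : ∀ p t d L → firstRead a e p (t + d) L ≡ Maybe.map (_+ d) (firstRead a e p t L)
  firstRead-delay p t d []      = refl
  firstRead-delay p t d (q ∷ L) with (p ≤ᵇ a) ∧ (e ≤ᵇ q)
  ... | true  = cong just (xy∙z≈xz∙y t d (a ∸ p))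
  ... | false rewrite xy∙z≈xz∙y t d (dist p q) = firstRead-delay q (t + dist p q) d L

  firstRead-finalSweep : ∀ {M} → e ≤ M → ∀ p t L →
    ∃ λ x → firstRead a e p t (L ++ 0 ∷ M ∷ []) ≡ just x × x ≤ t + pathLength p L + endpoint p L + a
  firstRead-finalSweep {M} e≤M p t [] with sweeps? a e p 0
  ... | yes sw = _ , firstRead-sweep sw t (M ∷ []) , (begin
    t + (a ∸ p)         ≤⟨ +-monoʳ-≤ t (m∸n≤m a p) ⟩
    t + a               ≤⟨ +-monoˡ-≤ a (m≤m+n t p) ⟩
    t + p + a           ≡⟨ cong (λ t′ → t′ + p + a) (sym (+-identityʳ t)) ⟩
    t + 0 + p + a       ∎)
    where open ≤-Reasoning
  ... | no ¬sw = _ , trans (firstRead-skip ¬sw t (M ∷ [])) (firstRead-sweep {a} {e} (sweeps z≤n e≤M) (t + dist p 0) []) ,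
    ≤-reflexive (cong (_+ a) (trans (cong (t +_) dist-0) (cong (_+ p) (sym (+-identityʳ t)))))
    where
    dist-0 : dist p 0 ≡ p
    dist-0 = trans (cong (p +_) (0∸n≡0 p)) (+-identityʳ p)
  firstRead-finalSweep {M} e≤M p t (q ∷ L) with sweeps? a e p q
  ... | yes sw = _ , firstRead-sweep sw t (L ++ 0 ∷ M ∷ []) ,
    ≤-trans (+-monoʳ-≤ t (m∸n≤m a p)) (+-monoˡ-≤ a (≤-trans (m≤m+n t _) (m≤m+n _ _)))
  ... | no ¬sw with firstRead-finalSweep e≤M q (t + dist p q) L
  ...   | x , read , x≤ = x , trans (firstRead-skip ¬sw t (L ++ 0 ∷ M ∷ [])) read ,
    ≤-trans x≤ (≤-reflexive (cong (λ u → u + endpoint q L + a) (+-assoc t (dist p q) _)))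

module _ {A : Set} (R : A → ℕ) (c : ℕ) where

  excursions : List A → List ℕ
  excursions = concatMap (λ b → R b ∷ c ∷ [])

  endpoint-excursions : ∀ bs → endpoint c (excursions bs) ≡ c
  endpoint-excursions []       = refl
  endpoint-excursions (b ∷ bs) = endpoint-excursions bs

  pathLength-excursions : (ℓ : A → ℕ) → ∀ {bs} → All (λ b → c + ℓ b ≡ R b) bs →
                          pathLength c (excursions bs) ≡ sum (map (λ b → ℓ b + ℓ b) bs)
  pathLength-excursions ℓ []                      = refl
  pathLength-excursions ℓ {b ∷ bs} (reach ∷ reaches)
    rewrite sym reach | dist-+ʳ c (ℓ b) | dist-+ˡ c (ℓ b) | pathLength-excursions ℓ reaches =
    sym (+-assoc (ℓ b) (ℓ b) _)

  firstRead-excursions : ∀ {a e} t → a < e → ∀ {bs} → All (λ b → ¬ Sweeps a e c (R b) × c ≤ R b) bs →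
                         firstRead a e c t (excursions bs) ≡ nothing
  firstRead-excursions t a<e []                   = refl
  firstRead-excursions {a} {e} t a<e {b ∷ bs} ((¬sw , c≤R) ∷ rest) = begin
    firstRead a e c t (R b ∷ c ∷ excursions bs)
      ≡⟨ firstRead-skip ¬sw t (c ∷ excursions bs) ⟩
    firstRead a e (R b) (t + dist c (R b)) (c ∷ excursions bs)
      ≡⟨ firstRead-skip (leftward-¬Sweeps a<e c≤R) (t + dist c (R b)) (excursions bs) ⟩
    firstRead a e c (t + dist c (R b) + dist (R b) c) (excursions bs)
      ≡⟨ firstRead-excursions _ a<e rest ⟩
    nothing ∎
    where open ≡-Reasoning

readTime : ℕ → ℕ → ℕ → List ℕ → ℕ
readTime a e p L = fromMaybe 0 (firstRead a e p 0 L)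

module _ {p c : ℕ} (ℓ : ℕ) (P S : List ℕ) (P-ends : endpoint p P ≡ c) where

  private
    τ : ℕ
    τ = pathLength p P

    readTime-++ : ∀ {a e} L {m} → firstRead a e c τ L ≡ m →
                  readTime a e p (P ++ L) ≡ fromMaybe 0 (firstRead a e p 0 P <∣> m)
    readTime-++ {a} {e} L refl = cong (fromMaybe 0) (trans (firstRead-++ a e p 0 P L)
                      (cong (λ q → firstRead a e p 0 P <∣> firstRead a e q τ L) P-ends))

    firstRead-detour : ∀ {a e} → a < e → ¬ Sweeps a e c (c + ℓ) →
      firstRead a e c τ (c + ℓ ∷ c ∷ S) ≡ Maybe.map (_+ (ℓ + ℓ)) (firstRead a e c τ S)
    firstRead-detour {a} {e} a<e ¬sw = begin
      firstRead a e c τ (c + ℓ ∷ c ∷ S)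
        ≡⟨ firstRead-skip ¬sw τ (c ∷ S) ⟩
      firstRead a e (c + ℓ) (τ + dist c (c + ℓ)) (c ∷ S)
        ≡⟨ firstRead-skip (leftward-¬Sweeps a<e (m≤m+n c ℓ)) (τ + dist c (c + ℓ)) S ⟩
      firstRead a e c (τ + dist c (c + ℓ) + dist (c + ℓ) c) S
        ≡⟨ cong (λ t → firstRead a e c t S)
                (trans (cong₂ (λ u v → τ + u + v) (dist-+ʳ c ℓ) (dist-+ˡ c ℓ)) (+-assoc τ ℓ ℓ)) ⟩
      firstRead a e c (τ + (ℓ + ℓ)) S
        ≡⟨ firstRead-delay a e c τ (ℓ + ℓ) S ⟩
      Maybe.map (_+ (ℓ + ℓ)) (firstRead a e c τ S) ∎
      where open ≡-Reasoning

  readTime-removeDetour-≤ : ∀ {a e} → a < e → ¬ Sweeps a e c (c + ℓ) → ∀ {x} → firstRead a e c τ S ≡ just x →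
    readTime a e p (P ++ S) ≤ readTime a e p (P ++ c + ℓ ∷ c ∷ S)
  readTime-removeDetour-≤ {a} {e} a<e ¬sw {x} read = begin
    readTime a e p (P ++ S)                          ≡⟨ readTime-++ S read ⟩
    fromMaybe 0 (firstRead a e p 0 P <∣> just x)     ≤⟨ later-≤ (firstRead a e p 0 P) ⟩
    fromMaybe 0 (firstRead a e p 0 P <∣> just (x + (ℓ + ℓ)))
      ≡⟨ sym (readTime-++ (c + ℓ ∷ c ∷ S) (trans (firstRead-detour a<e ¬sw) (cong (Maybe.map (_+ (ℓ + ℓ))) read))) ⟩
    readTime a e p (P ++ c + ℓ ∷ c ∷ S)              ∎
    where
    open ≤-Reasoning
    later-≤ : ∀ m → fromMaybe 0 (m <∣> just x) ≤ fromMaybe 0 (m <∣> just (x + (ℓ + ℓ)))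
    later-≤ (just _) = ≤-refl
    later-≤ nothing  = m≤m+n x (ℓ + ℓ)

  readTime-removeDetour-saves : ∀ {a e} → a < e → ¬ Sweeps a e c (c + ℓ) → ∀ {x} → firstRead a e c τ S ≡ just x →
    firstRead a e p 0 P ≡ nothing →
    readTime a e p (P ++ c + ℓ ∷ c ∷ S) ≡ readTime a e p (P ++ S) + (ℓ + ℓ)
  readTime-removeDetour-saves {a} {e} a<e ¬sw {x} read unread = begin
    readTime a e p (P ++ c + ℓ ∷ c ∷ S)
      ≡⟨ readTime-++ (c + ℓ ∷ c ∷ S) (trans (firstRead-detour a<e ¬sw) (cong (Maybe.map (_+ (ℓ + ℓ))) read)) ⟩
    fromMaybe 0 (firstRead a e p 0 P <∣> just (x + (ℓ + ℓ)))
      ≡⟨ cong (λ m → fromMaybe 0 (m <∣> just (x + (ℓ + ℓ)))) unread ⟩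
    x + (ℓ + ℓ)
      ≡⟨ cong (λ m → fromMaybe 0 (m <∣> just x) + (ℓ + ℓ)) (sym unread) ⟩
    fromMaybe 0 (firstRead a e p 0 P <∣> just x) + (ℓ + ℓ)
      ≡⟨ cong (_+ (ℓ + ℓ)) (sym (readTime-++ S read)) ⟩
    readTime a e p (P ++ S) + (ℓ + ℓ) ∎
    where open ≡-Reasoning

  readTime-removeDetour-cost : ∀ {D y} → firstRead c (c + ℓ) c τ S ≡ just y → y ≤ τ + D →
    readTime c (c + ℓ) p (P ++ S) ≤ readTime c (c + ℓ) p (P ++ c + ℓ ∷ c ∷ S) + D
  readTime-removeDetour-cost {D} {y} read y≤ = begin
    readTime c (c + ℓ) p (P ++ S)                     ≡⟨ readTime-++ S read ⟩
    fromMaybe 0 (firstRead c (c + ℓ) p 0 P <∣> just y) ≤⟨ earlier (firstRead c (c + ℓ) p 0 P) ⟩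
    fromMaybe 0 (firstRead c (c + ℓ) p 0 P <∣> just (τ + (c ∸ c))) + D
      ≡⟨ cong (_+ D) (sym (readTime-++ (c + ℓ ∷ c ∷ S) (firstRead-sweep {c} {c + ℓ} (sweeps ≤-refl ≤-refl) τ (c ∷ S)))) ⟩
    readTime c (c + ℓ) p (P ++ c + ℓ ∷ c ∷ S) + D     ∎
    where
    open ≤-Reasoning
    earlier : ∀ m → fromMaybe 0 (m <∣> just y) ≤ fromMaybe 0 (m <∣> just (τ + (c ∸ c))) + D
    earlier (just z) = m≤m+n z D
    earlier nothing  = ≤-trans y≤ (≤-reflexive (cong (_+ D) (sym (trans (cong (τ +_) (n∸n≡0 c)) (+-identityʳ τ)))))

module _ {n : ℕ} (s : Sizes n) where

  leftCoord-mono : ∀ {i j} → i F.≤ j → leftCoord s i ≤ leftCoord s j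
  leftCoord-mono i≤j = sum-filter-mono (F._<? _) (F._<? _) s (λ x<i → <-≤-trans x<i i≤j) (allFin n)

  rgt≤leftCoord : ∀ {i j} → i F.< j → rgt s i ≤ leftCoord s j
  rgt≤leftCoord {i} i<j =
    sum-filter-insert (F._<? i) (F._<? _) s (λ x<i → <-trans x<i i<j) (<-irrefl refl) i<j (allFin n) (∈-allFin i)

  rgt≤tapeLength : ∀ i → rgt s i ≤ tapeLength s
  rgt≤tapeLength i = subst (rgt s i ≤_) (cong (sum ∘ map s) (filter-all U? (All.universal-U (allFin n))))
    (sum-filter-insert (F._<? i) U? s _ (<-irrefl refl) _ (allFin n) (∈-allFin i))

  rgt-mono : ∀ {i j} → i F.≤ j → rgt s i ≤ rgt s j
  rgt-mono {i} {j} i≤j with FP.<-cmp i j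
  ... | tri< i<j _ _ = ≤-trans (rgt≤leftCoord i<j) (m≤m+n _ (s j))
  ... | tri≈ _ refl _ = ≤-refl
  ... | tri> _ _ j<i = ⊥-elim (<⇒≱ j<i i≤j)

  leftCoord<rgt : ∀ {i} → 1 ≤ s i → leftCoord s i < rgt s i
  leftCoord<rgt {i} = m<m+n (leftCoord s i)

  leftCoord≤rB : ∀ {b} → ValidMB b → leftCoord s (proj₁ b) ≤ rB s b
  leftCoord≤rB v = ≤-trans (m≤m+n _ _) (rgt-mono v)

  leftCoord+sB≡rB : ∀ {b} → ValidMB b → leftCoord s (proj₁ b) + sB s b ≡ rB s b
  leftCoord+sB≡rB v = m+[n∸m]≡n (leftCoord≤rB v)

  Misses : ℕ → ℕ → MiniBatch n → Set
  Misses a e b = ¬ Sweeps a e (leftCoord s (proj₁ b)) (rB s b)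

  descending⇒leftCoord-≤ : ∀ {i Ls} → All (F._< i) Ls → All (λ j → leftCoord s j ≤ leftCoord s i) Ls
  descending⇒leftCoord-≤ = All.map (leftCoord-mono ∘ <⇒≤)

  module _ (Bs : List (MiniBatch n)) where

    fibre : Fin n → List (MiniBatch n)
    fibre i = filter (λ b → proj₁ b ≟ i) Bs

    tour : List (Fin n) → List ℕ
    tour = concatMap (waypointsAt s Bs)

    All-fibre : ∀ {Q : MiniBatch n → Set} i → All Q Bs → All (λ b → proj₁ b ≡ i × Q b) (fibre i)
    All-fibre i QBs = All.zip (all-filter (λ b → proj₁ b ≟ i) Bs , filter⁺ (λ b → proj₁ b ≟ i) QBs)

    endpoint-waypointsAt : ∀ p i → endpoint p (waypointsAt s Bs i) ≡ leftCoord s i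
    endpoint-waypointsAt p i = endpoint-excursions (rB s) (leftCoord s i) (fibre i)

    endpoint-tour-≥ : ∀ {c pos Ls} → All (λ i → c ≤ leftCoord s i) Ls → c ≤ pos → c ≤ endpoint pos (tour Ls)
    endpoint-tour-≥ {pos = pos} {[]} [] c≤pos = c≤pos
    endpoint-tour-≥ {c} {pos} {i ∷ Ls} (c≤i ∷ c≤Ls) _ =
      subst (c ≤_) (sym (trans (endpoint-++ pos (waypointsAt s Bs i) (tour Ls))
                              (cong (λ q → endpoint q (tour Ls)) (endpoint-waypointsAt pos i))))
            (endpoint-tour-≥ c≤Ls c≤i)

    tour-length : All ValidMB Bs → ∀ {pos Ls} → AllPairs (flip F._<_) Ls → All (λ i → leftCoord s i ≤ pos) Ls →
      pathLength pos (tour Ls) + endpoint pos (tour Ls) ≡ pos + fibreSum _≟_ proj₁ (λ b → sB s b + sB s b) Ls Bs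
    tour-length valid {pos} {[]} [] [] = sym (+-identityʳ pos)
    tour-length valid {pos} {i ∷ Ls} (i>Ls ∷ desc) (i≤pos ∷ _) = begin
      pathLength pos (W ++ tour Ls) + endpoint pos (W ++ tour Ls)
        ≡⟨ cong₂ _+_ (pathLength-++ pos W (tour Ls)) (endpoint-++ pos W (tour Ls)) ⟩
      pathLength pos W + pathLength (endpoint pos W) (tour Ls) + endpoint (endpoint pos W) (tour Ls)
        ≡⟨ cong (λ q → pathLength pos W + pathLength q (tour Ls) + endpoint q (tour Ls)) (endpoint-waypointsAt pos i) ⟩
      pathLength pos W + pathLength c (tour Ls) + endpoint c (tour Ls)
        ≡⟨ +-assoc (pathLength pos W) _ _ ⟩
      pathLength pos W + (pathLength c (tour Ls) + endpoint c (tour Ls))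
        ≡⟨ cong₂ _+_ (cong₂ _+_ (dist-≥ i≤pos) excursion-length) (tour-length valid desc (descending⇒leftCoord-≤ i>Ls)) ⟩
      (pos ∸ c) + E + (c + F)
        ≡⟨ interchange (pos ∸ c) E c F ⟩
      (pos ∸ c) + c + (E + F)
        ≡⟨ cong (_+ (E + F)) (m∸n+n≡m i≤pos) ⟩
      pos + (E + F) ∎
      where
      open ≡-Reasoning
      W = waypointsAt s Bs i
      c = leftCoord s i
      E = sum (map (λ b → sB s b + sB s b) (fibre i))
      F = fibreSum _≟_ proj₁ (λ b → sB s b + sB s b) Ls Bs
      dist-≥ : ∀ {p q} → q ≤ p → dist p q ≡ p ∸ q
      dist-≥ {p} {q} q≤p = trans (cong ((p ∸ q) +_) (m≤n⇒m∸n≡0 q≤p)) (+-identityʳ (p ∸ q))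
      excursion-length : pathLength c (excursions (rB s) c (fibre i)) ≡ E
      excursion-length = pathLength-excursions (rB s) c (sB s)
        (All.map (λ { (refl , v) → leftCoord+sB≡rB v }) (All-fibre i valid))

    module _ {a e : ℕ} (a<e : a < e) {Q : Pred (Fin n) 0ℓ}
             (misses : All (λ b → Q (proj₁ b) → Misses a e b) Bs) (valid : All ValidMB Bs) where

      firstRead-waypointsAt : ∀ {pos i} t → leftCoord s i ≤ pos → Q i →
                              firstRead a e pos t (waypointsAt s Bs i) ≡ nothing
      firstRead-waypointsAt {pos} {i} t i≤pos Qi =
        trans (firstRead-skip (leftward-¬Sweeps a<e i≤pos) t (excursions (rB s) (leftCoord s i) (fibre i)))
              (firstRead-excursions (rB s) (leftCoord s i) _ a<e
                 (All.map harmless (All-fibre i (All.zip (misses , valid)))))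
        where
        harmless : ∀ {b} → proj₁ b ≡ i × ((Q (proj₁ b) → Misses a e b) × ValidMB b) →
                   ¬ Sweeps a e (leftCoord s i) (rB s b) × leftCoord s i ≤ rB s b
        harmless (refl , misses-b , v) = misses-b Qi , leftCoord≤rB v

      firstRead-tour : ∀ {pos Ls} t → AllPairs (flip F._<_) Ls → All (λ i → leftCoord s i ≤ pos) Ls → All Q Ls →
                       firstRead a e pos t (tour Ls) ≡ nothing
      firstRead-tour t [] [] [] = refl
      firstRead-tour {pos} {i ∷ Ls} t (i>Ls ∷ desc) (i≤pos ∷ _) (Qi ∷ QLs) =
        trans (firstRead-++ a e pos t (waypointsAt s Bs i) (tour Ls))
              (cong₂ _<∣>_ (firstRead-waypointsAt t i≤pos Qi)
                 (trans (cong (λ q → firstRead a e q (t + pathLength pos (waypointsAt s Bs i)) (tour Ls))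
                              (endpoint-waypointsAt pos i))
                        (firstRead-tour _ desc (descending⇒leftCoord-≤ i>Ls) QLs)))

-- B₁ = B₀ ++ (f , f) ∷ B₂, and the head stops at the files in the order Hi, f, Lo.
-- The schedule of B₁ is P, then the detour of (f , f), then S.
module Removal {n : ℕ} (s : Sizes n) (f : Fin n)
  (B₀ B₂ : List (MiniBatch n)) (B₀≢ff : All (_≢ (f , f)) B₀) (B₂≢ff : All ((f , f) ≢_) B₂)
  (Hi Lo : List (Fin n)) (stops : reverse (allFin n) ≡ Hi ++ f ∷ Lo)
  (Hi>f : All (f F.<_) Hi) (Lo<f : All (F._< f) Lo)
  (Hi-desc : AllPairs (flip F._<_) Hi) (Lo-desc : AllPairs (flip F._<_) Lo)
  (positive : ∀ i → 1 ≤ s i) (valid : All ValidMB (B₀ ++ (f , f) ∷ B₂)) where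

  B B′ : List (MiniBatch n)
  B  = B₀ ++ (f , f) ∷ B₂
  B′ = B₀ ++ B₂

  c m : ℕ
  c = leftCoord s f
  m = tapeLength s

  P S : List ℕ
  P = tour s B Hi ++ waypointsAt s B₀ f
  S = (excursions (rB s) c (fibre s B₂ f) ++ tour s B Lo) ++ 0 ∷ m ∷ []

  removeMB-B : removeMB (f , f) B ≡ B′
  removeMB-B = begin
    filter keep? (B₀ ++ (f , f) ∷ B₂)                ≡⟨ filter-++ keep? B₀ ((f , f) ∷ B₂) ⟩
    filter keep? B₀ ++ filter keep? ((f , f) ∷ B₂)   ≡⟨ cong₂ _++_ (filter-all keep? B₀≢ff)
                                                          (trans (filter-reject keep? (λ ¬refl → ¬refl refl))
                                                                 (filter-all keep? (All.map ≢-sym B₂≢ff))) ⟩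
    B₀ ++ B₂                                         ∎
    where
    open ≡-Reasoning
    keep? = λ (b : MiniBatch n) → ¬? (b ≟MB (f , f))

  fibre-B : ∀ {i} → i ≢ f → fibre s B i ≡ fibre s B′ i
  fibre-B {i} i≢f = begin
    fibre s B i                                              ≡⟨ filter-++ (λ b → proj₁ b ≟ i) B₀ ((f , f) ∷ B₂) ⟩
    fibre s B₀ i ++ filter (λ b → proj₁ b ≟ i) ((f , f) ∷ B₂) ≡⟨ cong (fibre s B₀ i ++_)
                                                                    (filter-reject (λ b → proj₁ b ≟ i) (i≢f ∘ sym)) ⟩
    fibre s B₀ i ++ fibre s B₂ i                             ≡⟨ filter-++ (λ b → proj₁ b ≟ i) B₀ B₂ ⟨
    fibre s B′ i                                             ∎
    where open ≡-Reasoning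

  private
    T₀ : List ℕ
    T₀ = 0 ∷ m ∷ []

    Hi≢f : All (_≢ f) Hi
    Hi≢f = All.map (≢-sym ∘ FP.<⇒≢) Hi>f

    Lo≢f : All (_≢ f) Lo
    Lo≢f = All.map FP.<⇒≢ Lo<f

    tour-B′ : ∀ {Ls} → All (_≢ f) Ls → tour s B′ Ls ≡ tour s B Ls
    tour-B′ []           = refl
    tour-B′ {i ∷ _} (i≢f ∷ Ls≢f) =
      cong₂ (λ bs l → (leftCoord s i ∷ excursions (rB s) (leftCoord s i) bs) ++ l) (sym (fibre-B i≢f)) (tour-B′ Ls≢f)

    schedule-split : ∀ Bs mid →
      excursions (rB s) c (fibre s Bs f) ≡ excursions (rB s) c (fibre s B₀ f) ++ mid ++ excursions (rB s) c (fibre s B₂ f) →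
      tour s Bs Hi ≡ tour s B Hi → tour s Bs Lo ≡ tour s B Lo → schedule s Bs ≡ P ++ mid ++ S
    schedule-split Bs mid at-f on-Hi on-Lo = begin
      tour s Bs (reverse (allFin n)) ++ T₀
        ≡⟨ cong (λ Ls → tour s Bs Ls ++ T₀) stops ⟩
      tour s Bs (Hi ++ f ∷ Lo) ++ T₀
        ≡⟨ cong (_++ T₀) (concatMap-++ (waypointsAt s Bs) Hi (f ∷ Lo)) ⟩
      (tour s Bs Hi ++ ((c ∷ excursions (rB s) c (fibre s Bs f)) ++ tour s Bs Lo)) ++ T₀
        ≡⟨ cong₂ (λ h l → (h ++ ((c ∷ excursions (rB s) c (fibre s Bs f)) ++ l)) ++ T₀) on-Hi on-Lo ⟩
      (tour s B Hi ++ ((c ∷ excursions (rB s) c (fibre s Bs f)) ++ tour s B Lo)) ++ T₀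
        ≡⟨ cong (λ x → (tour s B Hi ++ ((c ∷ x) ++ tour s B Lo)) ++ T₀) at-f ⟩
      (tour s B Hi ++ ((c ∷ (EX ++ mid ++ EY)) ++ tour s B Lo)) ++ T₀
        ≡⟨ regroup (tour s B Hi) EX mid EY (tour s B Lo) T₀ c ⟩
      P ++ mid ++ S ∎
      where
      open ≡-Reasoning
      EX = excursions (rB s) c (fibre s B₀ f)
      EY = excursions (rB s) c (fibre s B₂ f)

  schedule-B : schedule s B ≡ P ++ c + s f ∷ c ∷ S
  schedule-B = schedule-split B (c + s f ∷ c ∷ [])
    (trans (cong (excursions (rB s) c) fibre-f)
           (concatMap-++ (λ b → rB s b ∷ c ∷ []) (fibre s B₀ f) ((f , f) ∷ fibre s B₂ f)))
    refl refl
    where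
    fibre-f : fibre s B f ≡ fibre s B₀ f ++ (f , f) ∷ fibre s B₂ f
    fibre-f = trans (filter-++ (λ b → proj₁ b ≟ f) B₀ ((f , f) ∷ B₂))
                    (cong (fibre s B₀ f ++_) (filter-accept (λ b → proj₁ b ≟ f) refl))

  schedule-B′ : schedule s (removeMB (f , f) B) ≡ P ++ S
  schedule-B′ rewrite removeMB-B = schedule-split B′ []
    (trans (cong (excursions (rB s) c) (filter-++ (λ b → proj₁ b ≟ f) B₀ B₂))
           (concatMap-++ (λ b → rB s b ∷ c ∷ []) (fibre s B₀ f) (fibre s B₂ f)))
    (tour-B′ Hi≢f) (tour-B′ Lo≢f)

  endpoint-P : endpoint m P ≡ c
  endpoint-P = trans (endpoint-++ m (tour s B Hi) (waypointsAt s B₀ f))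
                     (endpoint-waypointsAt s B₀ (endpoint m (tour s B Hi)) f)

  private
    τ : ℕ
    τ = pathLength m P

    CL : List ℕ
    CL = tour s B Lo

    valid₀ : All ValidMB B₀
    valid₀ = ++⁻ˡ B₀ valid

    valid₂ : All ValidMB B₂
    valid₂ = All.tail (++⁻ʳ B₀ valid)

  module File (g : Fin n) where

    a e : ℕ
    a = leftCoord s g
    e = rgt s g

    a<e : a < e
    a<e = leftCoord<rgt s (positive g)

    respTime-B : respTime s B g ≡ readTime a e m (P ++ c + s f ∷ c ∷ S)
    respTime-B = cong (readTime a e m) schedule-B

    respTime-B′ : respTime s (removeMB (f , f) B) g ≡ readTime a e m (P ++ S)
    respTime-B′ = cong (readTime a e m) schedule-B′

    S-reads : ∃ λ x → firstRead a e c τ S ≡ just x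
    S-reads with firstRead-finalSweep a e (rgt≤tapeLength s g) c τ (excursions (rB s) c (fibre s B₂ f) ++ CL)
    ... | x , read , _ = x , read

    detour-misses : g ≢ f → ¬ Sweeps a e c (c + s f)
    detour-misses g≢f (sweeps c≤a e≤r) with FP.<-cmp g f
    ... | tri< g<f _ _ = <⇒≱ (<-≤-trans a<e (rgt≤leftCoord s g<f)) c≤a
    ... | tri≈ _ g≡f _ = g≢f g≡f
    ... | tri> _ _ f<g = <⇒≱ (<-≤-trans a<e e≤r) (rgt≤leftCoord s f<g)

    respTime-removal-≤ : g ≢ f → respTime s (removeMB (f , f) B) g ≤ respTime s B g
    respTime-removal-≤ g≢f = subst₂ _≤_ (sym respTime-B′) (sym respTime-B)
      (readTime-removeDetour-≤ (s f) P S endpoint-P a<e (detour-misses g≢f) (proj₂ S-reads))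

    P-unread : All (λ b → f F.≤ proj₁ b → Misses s a e b) B → firstRead a e m 0 P ≡ nothing
    P-unread misses = trans (firstRead-++ a e m 0 (tour s B Hi) (waypointsAt s B₀ f))
      (cong₂ _<∣>_ (firstRead-tour s B a<e misses valid 0 Hi-desc (All.map (λ {i} _ → Hi≤m i) Hi>f) (All.map <⇒≤ Hi>f))
                   (firstRead-waypointsAt s B₀ a<e (++⁻ˡ B₀ misses) valid₀ _
                      (endpoint-tour-≥ s B (All.map (λ f<i → leftCoord-mono s (<⇒≤ f<i)) Hi>f)
                                         (≤-trans (m≤m+n c (s f)) (rgt≤tapeLength s f)))
                      FP.≤-refl))
      where
      Hi≤m : ∀ i → leftCoord s i ≤ m
      Hi≤m i = ≤-trans (m≤m+n _ (s i)) (rgt≤tapeLength s i)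

    respTime-removal-saves : g ≢ f → All (λ b → f F.≤ proj₁ b → Misses s a e b) B →
      respTime s B g ≡ respTime s (removeMB (f , f) B) g + (s f + s f)
    respTime-removal-saves g≢f misses = trans respTime-B (trans
      (readTime-removeDetour-saves (s f) P S endpoint-P a<e (detour-misses g≢f) (proj₂ S-reads) (P-unread misses))
      (cong (_+ (s f + s f)) (sym respTime-B′)))

    left-misses : g F.< f → All (λ b → f F.≤ proj₁ b → Misses s a e b) B
    left-misses g<f = All.universal (λ b f≤b (sweeps b≤a _) →
      <⇒≱ (<-≤-trans a<e (rgt≤leftCoord s g<f)) (≤-trans (leftCoord-mono s f≤b) b≤a)) B

    uncovered-misses : inFB s B g ≡ false → All (λ b → f F.≤ proj₁ b → Misses s a e b) B
    uncovered-misses uncovered =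
      All.map (λ ¬covers _ (sweeps b≤a e≤r) → ¬covers (sweepTest-complete (sweeps (s≤s b≤a) e≤r)))
              (¬Any⇒All¬ B (λ covers → subst T uncovered (Any.any⁺ (λ b → inFb s b g) covers)))

  Sig K : ℕ
  Sig = sumBatchesLeftOf s B f
  K   = c + Sig

  private
    Lo-unique : Unique Lo
    Lo-unique = AllPairs-map (≢-sym ∘ FP.<⇒≢) Lo-desc

    Lo-left : All (λ i → lft s i < lft s f) Lo
    Lo-left = All.map (λ {i} i<f → s≤s (<-≤-trans (leftCoord<rgt s (positive i)) (rgt≤leftCoord s i<f))) Lo<f

    tour-Lo-length : pathLength c CL + endpoint c CL ≤ c + (Sig + Sig)
    tour-Lo-length = begin
      pathLength c CL + endpoint c CL
        ≡⟨ tour-length s B valid Lo-desc (descending⇒leftCoord-≤ s Lo<f) ⟩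
      c + fibreSum _≟_ proj₁ (λ b → sB s b + sB s b) Lo B
        ≤⟨ +-monoʳ-≤ c (fibreSum-≤ _≟_ proj₁ _ (λ i → lft s i <? lft s f) Lo-unique Lo-left B) ⟩
      c + sum (map (λ b → sB s b + sB s b) leftBatches)
        ≡⟨ cong (c +_) (sum-map-+ (sB s) (sB s) leftBatches) ⟩
      c + (Sig + Sig) ∎
      where
      open ≤-Reasoning
      leftBatches = filter (λ b → lB s b <? lft s f) B

    S-reads-f : ∀ bs → All (λ b → proj₁ b ≡ f × ValidMB b) bs →
      ∃ λ y → firstRead c (c + s f) c τ ((excursions (rB s) c bs ++ CL) ++ 0 ∷ m ∷ []) ≡ just y × y ≤ τ + (K + K)
    S-reads-f (b ∷ bs) ((b₁≡f , v) ∷ _) =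
      _ , firstRead-sweep {c} {c + s f} (sweeps ≤-refl (rgt-mono s (subst (F._≤ proj₂ b) b₁≡f v))) τ
            ((c ∷ excursions (rB s) c bs ++ CL) ++ 0 ∷ m ∷ []) ,
      +-monoʳ-≤ τ (≤-trans (≤-reflexive (n∸n≡0 c)) z≤n)
    S-reads-f [] _ with firstRead-finalSweep c (c + s f) (rgt≤tapeLength s f) c τ CL
    ... | y , read , y≤ = y , read , (begin
      y                                              ≤⟨ y≤ ⟩
      τ + pathLength c CL + endpoint c CL + c        ≡⟨ cong (_+ c) (+-assoc τ _ _) ⟩
      τ + (pathLength c CL + endpoint c CL) + c      ≤⟨ +-monoˡ-≤ c (+-monoʳ-≤ τ tour-Lo-length) ⟩
      τ + (c + (Sig + Sig)) + c                      ≡⟨ rearrange τ c Sig ⟩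
      τ + (K + K)                                    ∎)
      where
      open ≤-Reasoning
      rearrange : ∀ t x y → t + (x + (y + y)) + x ≡ t + ((x + y) + (x + y))
      rearrange = solve-∀

  respTime-removal-cost : respTime s (removeMB (f , f) B) f ≤ respTime s B f + (K + K)
  respTime-removal-cost with S-reads-f (fibre s B₂ f) (All-fibre s B₂ f valid₂)
  ... | y , read , y≤ = subst₂ _≤_ (sym (File.respTime-B′ f)) (cong (_+ (K + K)) (sym (File.respTime-B f)))
    (readTime-removeDetour-cost (s f) P S endpoint-P read y≤)

  private
    allFin↭ : allFin n ↭ Hi ++ f ∷ Lo
    allFin↭ = ↭-trans (↭-sym (↭.↭-reverse (allFin n))) (↭-reflexive stops)

    Hi-right : All (λ i → lft s f < lft s i) Hi
    Hi-right = All.map (λ f<i → s≤s (<-≤-trans (leftCoord<rgt s (positive f)) (rgt≤leftCoord s f<i))) Hi>f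

    sum-allFin : (h : Fin n → ℕ) → sum (map h (allFin n)) ≡ sum (map h Hi) + (h f + sum (map h Lo))
    sum-allFin h = trans (sum-map-↭ h allFin↭) (trans (cong sum (map-++ h Hi (f ∷ Lo))) (sum-++ (map h Hi) _))

  module Accounting (req : Requests n) where

    Uncovered? : Decidable (λ g → inFB s B g ≡ false)
    Uncovered? g = inFB s B g Bool.≟ false

    reqLeftOf≡ : reqLeftOf s req f ≡ sum (map req Lo)
    reqLeftOf≡ = trans (sum-map-↭ req (↭.filter-↭ left? allFin↭)) (cong (sum ∘ map req) (begin
      filter left? (Hi ++ f ∷ Lo)                ≡⟨ filter-++ left? Hi (f ∷ Lo) ⟩
      filter left? Hi ++ filter left? (f ∷ Lo)   ≡⟨ cong₂ _++_ (filter-none left? (All.map <⇒≯ Hi-right))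
                                                       (trans (filter-reject left? (<-irrefl refl)) (filter-all left? Lo-left)) ⟩
      Lo                                         ∎))
      where
      open ≡-Reasoning
      left? = λ g → lft s g <? lft s f

    reqRightUncovered≡ : reqRightUncovered s req B f ≡ sum (map req (filter Uncovered? Hi))
    reqRightUncovered≡ = trans (sum-map-↭ req (↭.filter-↭ right? (↭.filter-↭ Uncovered? allFin↭)))
                               (cong (sum ∘ map req) (begin
      filter right? (filter Uncovered? (Hi ++ f ∷ Lo))
        ≡⟨ cong (filter right?) (filter-++ Uncovered? Hi (f ∷ Lo)) ⟩
      filter right? (filter Uncovered? Hi ++ filter Uncovered? (f ∷ Lo))
        ≡⟨ filter-++ right? (filter Uncovered? Hi) _ ⟩
      filter right? (filter Uncovered? Hi) ++ filter right? (filter Uncovered? (f ∷ Lo))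
        ≡⟨ cong₂ _++_ (filter-all right? (filter⁺ Uncovered? Hi-right))
                      (filter-none right? (filter⁺ Uncovered? (<-irrefl refl ∷ All.map <⇒≯ Lo-left))) ⟩
      filter Uncovered? Hi ++ []
        ≡⟨ ++-identityʳ _ ⟩
      filter Uncovered? Hi ∎))
      where
      open ≡-Reasoning
      right? = λ g → lft s f <? lft s g

    private
      new old : Fin n → ℕ
      new g = req g * respTime s (removeMB (f , f) B) g
      old g = req g * respTime s B g

      k : ℕ
      k = s f + s f

      gain : ∀ {g} → respTime s B g ≡ respTime s (removeMB (f , f) B) g + k → new g + k * req g ≤ old g
      gain {g} saves = ≤-reflexive (begin
        req g * x + k * req g   ≡⟨ distrib (req g) x k ⟩
        req g * (x + k)         ≡⟨ cong (req g *_) saves ⟨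
        old g                   ∎)
        where
        open ≡-Reasoning
        x = respTime s (removeMB (f , f) B) g
        distrib : ∀ r x k → r * x + k * r ≡ r * (x + k)
        distrib = solve-∀

      Hi-block : sum (map new Hi) + k * sum (map req (filter Uncovered? Hi)) ≤ sum (map old Hi)
      Hi-block = subst (λ z → sum (map new Hi) + z ≤ sum (map old Hi)) (sum-map-*ˡ k req (filter Uncovered? Hi))
        (sum-map-filter-gain Uncovered?
          (All.map (λ {i} f<i → *-monoʳ-≤ (req i) (File.respTime-removal-≤ i (≢-sym (FP.<⇒≢ f<i)))) Hi>f)
          (All.map (λ {i} f<i uncovered → gain (File.respTime-removal-saves i (≢-sym (FP.<⇒≢ f<i))
                                                  (File.uncovered-misses i uncovered))) Hi>f))

      Lo-block : sum (map new Lo) + k * sum (map req Lo) ≤ sum (map old Lo)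
      Lo-block = subst (λ z → sum (map new Lo) + z ≤ sum (map old Lo)) (sum-map-*ˡ k req Lo)
        (sum-map-gain (All.map (λ {i} i<f → gain (File.respTime-removal-saves i (FP.<⇒≢ i<f) (File.left-misses i i<f)))
                               Lo<f))

      f-block : new f ≤ old f + req f * (K + K)
      f-block = ≤-trans (*-monoʳ-≤ (req f) respTime-removal-cost) (≤-reflexive (*-distribˡ-+ (req f) _ (K + K)))

    v-removal-bound : v s req (removeMB (f , f) B) + k * (reqLeftOf s req f + reqRightUncovered s req B f)
                      ≤ v s req B + req f * (K + K)
    v-removal-bound = begin
      v s req (removeMB (f , f) B) + k * (reqLeftOf s req f + reqRightUncovered s req B f)
        ≡⟨ cong₂ (λ u w → u + k * w) (sum-allFin new) (cong₂ _+_ reqLeftOf≡ reqRightUncovered≡) ⟩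
      sum (map new Hi) + (new f + sum (map new Lo)) + k * (sum (map req Lo) + sum (map req (filter Uncovered? Hi)))
        ≡⟨ regroup-new (sum (map new Hi)) (new f) (sum (map new Lo)) k (sum (map req Lo)) _ ⟩
      (sum (map new Hi) + k * sum (map req (filter Uncovered? Hi))) + (new f + (sum (map new Lo) + k * sum (map req Lo)))
        ≤⟨ +-mono-≤ Hi-block (+-mono-≤ f-block Lo-block) ⟩
      sum (map old Hi) + (old f + req f * (K + K) + sum (map old Lo))
        ≡⟨ regroup-old (sum (map old Hi)) (old f) (req f * (K + K)) (sum (map old Lo)) ⟩
      sum (map old Hi) + (old f + sum (map old Lo)) + req f * (K + K)
        ≡⟨ cong (_+ req f * (K + K)) (sum-allFin old) ⟨
      v s req B + req f * (K + K) ∎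
      where
      open ≤-Reasoning
      regroup-new : ∀ h x l k u r → h + (x + l) + k * (u + r) ≡ (h + k * r) + (x + (l + k * u))
      regroup-new = solve-∀
      regroup-old : ∀ h x y l → h + (x + y + l) ≡ h + (x + l) + y
      regroup-old = solve-∀

    v-removal-< : req f * (lft s f + Sig) < s f * (reqLeftOf s req f + reqRightUncovered s req B f) →
                  v s req (removeMB (f , f) B) < v s req B
    v-removal-< hyp = +-cancelʳ-< (k * X) _ _ (≤-<-trans v-removal-bound (+-monoʳ-< (v s req B) cost<gain))
      where
      X = reqLeftOf s req f + reqRightUncovered s req B f
      half : req f * K < s f * X
      half = ≤-<-trans (*-monoʳ-≤ (req f) (+-monoˡ-≤ Sig (n≤1+n c))) hyp
      cost<gain : req f * (K + K) < k * X
      cost<gain = subst₂ _<_ (sym (*-distribˡ-+ (req f) K K)) (sym (*-distribʳ-+ X (s f) (s f))) (+-mono-< half half)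

corollary4 : {n : ℕ} (s : Sizes n) (req : Requests n) (B₁ : List (MiniBatch n)) (f : Fin n)
    → (∀ i → 1 ≤ s i)
    → Unique B₁
    → All ValidMB B₁
    → (f , f) ∈ B₁
    → req f * (lft s f + sumBatchesLeftOf s B₁ f)
        < s f * (reqLeftOf s req f + reqRightUncovered s req B₁ f)
    → v s req (removeMB (f , f) B₁) < v s req B₁
corollary4 {n} s req B₁ f positive unique valid ff∈B₁ hyp
  with B₀ , B₂ , refl ← ∈-∃++ ff∈B₁
  with Hi , Lo , stops ← ∈-∃++ (Any.reverse⁺ (∈-allFin f)) =
  let B₀≢ff , ff≢B₂ , _ , _ = AllPairs-split B₀ unique
      Hi>f , Lo<f , Hi-desc , Lo-desc = AllPairs-split Hi
        (subst (AllPairs (flip F._<_)) stops (AllPairs-reverse⁺ (AllPairs.tabulate⁺-< id)))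
  in Removal.Accounting.v-removal-< s f B₀ B₂ B₀≢ff ff≢B₂ Hi Lo stops Hi>f Lo<f Hi-desc Lo-desc positive valid req hyp
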